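{- Let $n\geqslant 3$ be an integer and let $q$ be a prime. Let $\vec{a}=(a_1,\ldots,a_n)\in\mathbb{Z}^n$ with $a_i\not\equiv 0\pmod q$ for all $i$, and let $\vec{h}=(h_1,\ldots,h_n)\in\mathbb{N}^n$ with $1\leqslant h_1\leqslant\cdots\leqslant h_n$. Then $$\#\mathcal{U}_{n,q}(\vec{a},\vec{h})\leqslant \left(\frac{h_1h_2h_3}{q}+\frac{h_2^3}{q}+h_2\right)\exp\left(O\left(\frac{\log q}{\log\log q}\right)\right),$$ where the implied constant depends only on $n$.
   Context: $\mathbb{F}_q$ is identified with $\{0,1,\ldots,q-1\}$, and $\|\zeta\|$ is the distance from a real $\zeta$ to the nearest integer. $\mathcal{U}_{n,q}(\vec{a},\vec{h})$ denotes the set of $u\in\mathbb{F}_q$ for which the Bohr set $\{s\in\mathbb{F}_q:\ \|a_j u^{j} s/q\|\leqslant h_j/q,\ j=1,\ldots,n\}$ contains some $s\neq 0$; equivalently, the set of $u\in\mathbb{F}_q$ for which there exist $s\in\{1,\ldots,q-1\}$ and integers $x_j$ with $|x_j|\leqslant h_j$ and $s a_j u^{j}\equiv x_j\pmod q$, $j=1,\ldots,n$. -}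

module Defs where

open import Data.Nat using (ℕ; suc; _≤_; _<_; _*_; _/_)
open import Data.Nat.Logarithm using (⌊log₂_⌋)
open import Data.Fin using (Fin; toℕ)
open import Data.Integer as ℤ using (ℤ; +_; ∣_∣)
open import Data.Integer.Divisibility as ℤD using ()
open import Data.Product using (Σ; _×_)

-- Indices are shifted: coordinate j : Fin n stands for index toℕ j + 1.
InU : (n q : ℕ) → (Fin n → ℤ) → (Fin n → ℕ) → Fin q → Set
InU n q a h u =
  Σ ℕ λ s → 1 ≤ s × s < q ×
    ((j : Fin n) → Σ ℤ λ x → ∣ x ∣ ≤ h j ×
       (+ q) ℤD.∣ ((+ s) ℤ.* a j ℤ.* ((+ toℕ u) ℤ.^ suc (toℕ j)) ℤ.- x))

-- Integer proxy for log q / log log q :  ⌊log₂ q⌋ / (1 + ⌊log₂ ⌊log₂ q⌋⌋).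
-- exp(O(log q / log log q)) is rendered as 2 ^ (C * logRatio q) with C depending only on n.
logRatio : ℕ → ℕ
logRatio q = ⌊log₂ q ⌋ / suc ⌊log₂ ⌊log₂ q ⌋ ⌋

module Submission where

-- For u ≠ 0 in U, with multiplier s and coordinates x_j ≡ s a_j u^j (mod q), the pair (x₁, x₂)
-- determines u, since s a₁ u and s a₂ u² determine u once the unit s is cancelled; moreover
-- x₁, x₃ are units and a₂² x₁ x₃ ≡ a₁ a₃ x₂² (mod q). Hence u is recovered from x₂ (2 h₂ + 1
-- choices), the integer M = x₁ x₃ with ∣M∣ ≤ h₁ h₃ lying in a residue class fixed by x₂ (at most
-- 1 + 2 h₁ h₃ / q choices) and a signed divisor x₁ of M (at most 2 τ(∣M∣) choices). If h₁ h₃ < q²,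
-- then τ(∣M∣) = exp(O(log q / log log q)) by the bound τ(N)^k ≤ 2^(k 4^k) N with k ≈ (log log q) / 4;
-- otherwise the trivial bound #U ≤ q suffices.

module ListCounting where

  open import Data.Nat using (suc; _+_; _*_; _≤_; z≤n; s≤s)
  open import Data.Nat.Properties using (+-mono-≤; +-suc; ≤-reflexive; ≤-trans; module ≤-Reasoning)
  open import Data.Fin using (Fin)
  open import Data.List using (List; []; _∷_; _++_; length; concatMap; allFin)
  open import Data.List.Properties using (length-++; length-tabulate)
  open import Data.List.Membership.Propositional using (_∈_)
  open import Data.List.Membership.Propositional.Properties using (∈-∃++; ∈-concatMap⁺; ∈-allFin)
  open import Data.List.Relation.Binary.Subset.Propositional using (_⊆_)
  open import Data.List.Relation.Unary.All as All using (All; []; _∷_)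
  open import Data.List.Relation.Unary.Any as Any using (here; there)
  open import Data.List.Relation.Unary.Unique.Propositional using (Unique; []; _∷_)
  open import Data.Empty using (⊥-elim)
  open import Data.Product using (_,_)
  open import Function using (_∘_; id)
  open import Relation.Binary.PropositionalEquality using (_≡_; _≢_; refl; cong)

  private
    variable
      A B : Set

  ∈-++-∷⁻ : ∀ {x y : A} ys zs → y ∈ ys ++ x ∷ zs → x ≢ y → y ∈ ys ++ zs
  ∈-++-∷⁻ []       zs (here refl) x≢y = ⊥-elim (x≢y refl)
  ∈-++-∷⁻ []       zs (there y∈)  _   = y∈
  ∈-++-∷⁻ (_ ∷ ys) zs (here refl) _   = here refl
  ∈-++-∷⁻ (_ ∷ ys) zs (there y∈)  x≢y = there (∈-++-∷⁻ ys zs y∈ x≢y)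

  Unique-⊆⇒length≤ : {xs ys : List A} → Unique xs → xs ⊆ ys → length xs ≤ length ys
  Unique-⊆⇒length≤ [] _ = z≤n
  Unique-⊆⇒length≤ {xs = x ∷ xs} (x∉xs ∷ uxs) xs⊆ys with ∈-∃++ (xs⊆ys (here refl))
  ... | ys₁ , ys₂ , refl = begin
    suc (length xs)                ≤⟨ s≤s (Unique-⊆⇒length≤ uxs xs⊆ys₁++ys₂) ⟩
    suc (length (ys₁ ++ ys₂))      ≡⟨ cong suc (length-++ ys₁) ⟩
    suc (length ys₁ + length ys₂)  ≡⟨ +-suc (length ys₁) (length ys₂) ⟨
    length ys₁ + length (x ∷ ys₂)  ≡⟨ length-++ ys₁ ⟨
    length (ys₁ ++ x ∷ ys₂)        ∎
    where
    open ≤-Reasoning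
    xs⊆ys₁++ys₂ : xs ⊆ ys₁ ++ ys₂
    xs⊆ys₁++ys₂ y∈ = ∈-++-∷⁻ ys₁ ys₂ (xs⊆ys (there y∈)) (All.lookup x∉xs y∈)

  module _ {P : A → Set} (code : ∀ {x} → P x → B)
           (code-injective : ∀ {x y} (p : P x) (p′ : P y) → code p ≡ code p′ → x ≡ y) where

    private
      codes : {xs : List A} → All P xs → List B
      codes = All.reduce code

      length-codes : {xs : List A} (ps : All P xs) → length (codes ps) ≡ length xs
      length-codes []       = refl
      length-codes (_ ∷ ps) = cong suc (length-codes ps)

      codes-unique : {xs : List A} (ps : All P xs) → Unique xs → Unique (codes ps)
      codes-unique []       []                  = []
      codes-unique {x ∷ _} (p ∷ ps) (x∉ ∷ uxs) = fresh ps x∉ ∷ codes-unique ps uxs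
        where
        fresh : ∀ {ys} (qs : All P ys) → All (x ≢_) ys → All (code p ≢_) (codes qs)
        fresh []       []           = []
        fresh (q ∷ qs) (x≢y ∷ x≢ys) = (λ eq → x≢y (code-injective p q eq)) ∷ fresh qs x≢ys

      codes-⊆ : {xs : List A} {ys : List B} (ps : All P xs) → (∀ {x} (p : P x) → code p ∈ ys) →
                codes ps ⊆ ys
      codes-⊆ (p ∷ _)  code∈ (here refl) = code∈ p
      codes-⊆ (_ ∷ ps) code∈ (there c∈)  = codes-⊆ ps code∈ c∈

    Unique-length≤-by-code : {xs : List A} {ys : List B} → (∀ {x} (p : P x) → code p ∈ ys) →
                             Unique xs → All P xs → length xs ≤ length ys
    Unique-length≤-by-code {xs} {ys} code∈ uxs ps = begin
      length xs          ≡⟨ length-codes ps ⟨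
      length (codes ps)  ≤⟨ Unique-⊆⇒length≤ (codes-unique ps uxs) (codes-⊆ ps code∈) ⟩
      length ys          ∎
      where open ≤-Reasoning

  length-concatMap≤ : ∀ (f : A → List B) {b} xs → (∀ {x} → x ∈ xs → length (f x) ≤ b) →
                      length (concatMap f xs) ≤ length xs * b
  length-concatMap≤ f     []       _   = z≤n
  length-concatMap≤ f {b} (x ∷ xs) f≤b = begin
    length (f x ++ concatMap f xs)          ≡⟨ length-++ (f x) ⟩
    length (f x) + length (concatMap f xs)  ≤⟨ +-mono-≤ (f≤b (here refl)) (length-concatMap≤ f xs (f≤b ∘ there)) ⟩
    length (x ∷ xs) * b                     ∎
    where open ≤-Reasoning

  ∈-concatMap⁺′ : ∀ (f : A → List B) {x y xs} → x ∈ xs → y ∈ f x → y ∈ concatMap f xs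
  ∈-concatMap⁺′ f x∈xs y∈fx = ∈-concatMap⁺ f (Any.map (λ { refl → y∈fx }) x∈xs)

  Unique⇒length≤n : ∀ {n} {xs : List (Fin n)} → Unique xs → length xs ≤ n
  Unique⇒length≤n {n} uxs =
    ≤-trans (Unique-⊆⇒length≤ uxs (λ {x} _ → ∈-allFin x)) (≤-reflexive (length-tabulate id))

module Divisors where

  open ListCounting
  open import Data.Nat
    using (ℕ; zero; suc; _+_; _*_; _^_; _∸_; _≤_; _<_; z≤n; s≤s; NonZero; NonTrivial; _/_; _%_; _<?_;
           ≢-nonZero; ≢-nonZero⁻¹; n>1⇒nonTrivial)
  open import Data.Nat.Properties
  open import Data.Nat.Divisibility
  open import Data.Nat.DivMod using (m*[n/m]≡n; m≡m%n+[m/n]*n; m%n<n)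
  open import Data.Nat.GCD using (gcd; gcd[m,n]∣m; gcd[m,n]∣n; gcd[m,n]≢0)
  open import Data.Nat.Coprimality using (Coprime; coprime-/gcd; coprime-divisor)
  open import Data.Nat.Induction using (<-wellFounded)
  open import Data.Nat.Primality
    using (Prime; prime⇒irreducible; prime⇒nonZero;
           _Rough_; rough⇒≤; ∤⇒rough-suc; rough∧∣⇒rough; rough∧∣⇒prime)
  open import Data.Nat.Tactic.RingSolver using (solve-∀)
  open import Data.List using (List; length; map; concatMap; filter; upTo)
  open import Data.List.Properties using (length-map; length-upTo; length-filter)
  open import Data.List.Membership.Propositional using (_∈_)
  open import Data.List.Membership.Propositional.Properties using (∈-filter⁺; ∈-filter⁻; ∈-upTo⁺; ∈-map⁺)
  open import Data.List.Relation.Unary.Unique.Propositional using (Unique)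
  open import Data.List.Relation.Unary.Unique.Propositional.Properties using (filter⁺; upTo⁺)
  open import Data.Product using (∃; ∃₂; _×_; _,_; proj₂)
  open import Data.Sum using (inj₁; inj₂)
  open import Function using (_∘_)
  open import Induction.WellFounded using (Acc; acc)
  open import Relation.Binary.PropositionalEquality
    using (_≡_; refl; sym; trans; cong; subst; subst₂; module ≡-Reasoning)
  open import Relation.Nullary using (yes; no)
  open import Relation.Nullary.Negation using (contradiction)

  divisors : ℕ → List ℕ
  divisors n = filter (_∣? n) (upTo (suc n))

  τ : ℕ → ℕ
  τ n = length (divisors n)

  divisors-unique : ∀ n → Unique (divisors n)
  divisors-unique n = filter⁺ (_∣? n) (upTo⁺ (suc n))

  ∈-divisors⁺ : ∀ {d n} .{{_ : NonZero n}} → d ∣ n → d ∈ divisors n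
  ∈-divisors⁺ d∣n = ∈-filter⁺ (_∣? _) (∈-upTo⁺ (s≤s (∣⇒≤ d∣n))) d∣n

  ∈-divisors⁻ : ∀ {d} n → d ∈ divisors n → d ∣ n
  ∈-divisors⁻ n d∈ = proj₂ (∈-filter⁻ (_∣? n) {xs = upTo (suc n)} d∈)

  τ[n]≤1+n : ∀ n → τ n ≤ suc n
  τ[n]≤1+n n = ≤-trans (length-filter (_∣? n) (upTo (suc n))) (≤-reflexive (length-upTo (suc n)))

  τ≤length : ∀ n {ds : List ℕ} → (∀ {d} → d ∣ n → d ∈ ds) → τ n ≤ length ds
  τ≤length n ∣⇒∈ = Unique-⊆⇒length≤ (divisors-unique n) (∣⇒∈ ∘ ∈-divisors⁻ n)

  ∣*⇒∣×∣ : ∀ {d} a b .{{_ : NonZero a}} → d ∣ a * b →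
           ∃₂ λ d₁ d₂ → d₁ ∣ a × d₂ ∣ b × d ≡ d₁ * d₂
  ∣*⇒∣×∣ {d} a b d∣ab = g , d / g , gcd[m,n]∣n d a , d/g∣b , sym g*[d/g]≡d
    where
    g : ℕ
    g = gcd d a
    instance
      g≢0 : NonZero g
      g≢0 = ≢-nonZero (gcd[m,n]≢0 d a (inj₂ (≢-nonZero⁻¹ a)))
    g*[d/g]≡d : g * (d / g) ≡ d
    g*[d/g]≡d = m*[n/m]≡n (gcd[m,n]∣m d a)
    g*[a/g*b]≡a*b : g * (a / g * b) ≡ a * b
    g*[a/g*b]≡a*b = trans (sym (*-assoc g (a / g) b)) (cong (_* b) (m*[n/m]≡n (gcd[m,n]∣n d a)))
    d/g∣b : d / g ∣ b
    d/g∣b = coprime-divisor (coprime-/gcd d a)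
              (*-cancelˡ-∣ g (subst₂ _∣_ (sym g*[d/g]≡d) (sym g*[a/g*b]≡a*b) d∣ab))

  τ-submultiplicative : ∀ a b .{{_ : NonZero a}} .{{_ : NonZero b}} → τ (a * b) ≤ τ a * τ b
  τ-submultiplicative a b = begin
    τ (a * b)        ≤⟨ τ≤length (a * b) ∣ab⇒∈products ⟩
    length products  ≤⟨ length-concatMap≤ multiples (divisors a) (λ {d₁} _ → length-multiples d₁) ⟩
    τ a * τ b        ∎
    where
    open ≤-Reasoning
    instance
      ab≢0 : NonZero (a * b)
      ab≢0 = m*n≢0 a b
    multiples : ℕ → List ℕ
    multiples d₁ = map (d₁ *_) (divisors b)
    length-multiples : ∀ d₁ → length (multiples d₁) ≤ τ b
    length-multiples d₁ = ≤-reflexive (length-map (d₁ *_) (divisors b))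
    products : List ℕ
    products = concatMap multiples (divisors a)
    ∣ab⇒∈products : ∀ {d} → d ∣ a * b → d ∈ products
    ∣ab⇒∈products d∣ab with ∣*⇒∣×∣ a b d∣ab
    ... | d₁ , d₂ , d₁∣a , d₂∣b , refl =
      ∈-concatMap⁺′ multiples (∈-divisors⁺ d₁∣a) (∈-map⁺ (d₁ *_) (∈-divisors⁺ d₂∣b))

  ∣p^e⇒≡p^i : ∀ {p} → Prime p → ∀ e {d} → d ∣ p ^ e → ∃ λ i → i ≤ e × d ≡ p ^ i
  ∣p^e⇒≡p^i {p} p-prime zero d∣1 = 0 , z≤n , ∣1⇒≡1 d∣1
  ∣p^e⇒≡p^i {p} p-prime (suc e) {d} d∣p^[1+e] with p ∣? d
  ... | no p∤d = let i , i≤e , d≡p^i = ∣p^e⇒≡p^i p-prime e (coprime-divisor p∤d⇒coprime d∣p^[1+e])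
                 in i , m≤n⇒m≤1+n i≤e , d≡p^i
    where
    p∤d⇒coprime : Coprime d p
    p∤d⇒coprime (c∣d , c∣p) with prime⇒irreducible p-prime c∣p
    ... | inj₁ c≡1 = c≡1
    ... | inj₂ refl = contradiction c∣d p∤d
  ... | yes (divides d′ refl) = let i , i≤e , d′≡p^i = ∣p^e⇒≡p^i p-prime e d′∣p^e
                                in suc i , s≤s i≤e , trans (*-comm d′ p) (cong (p *_) d′≡p^i)
    where
    instance
      p≢0 : NonZero p
      p≢0 = prime⇒nonZero p-prime
    d′∣p^e : d′ ∣ p ^ e
    d′∣p^e = *-cancelˡ-∣ p (subst₂ _∣_ (*-comm d′ p) refl d∣p^[1+e])

  τ[p^e]≤1+e : ∀ {p} → Prime p → ∀ e → τ (p ^ e) ≤ suc e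
  τ[p^e]≤1+e {p} p-prime e = begin
    τ (p ^ e)                           ≤⟨ τ≤length (p ^ e) ∣⇒∈powers ⟩
    length (map (p ^_) (upTo (suc e)))  ≡⟨ trans (length-map (p ^_) (upTo (suc e))) (length-upTo (suc e)) ⟩
    suc e                               ∎
    where
    open ≤-Reasoning
    ∣⇒∈powers : ∀ {d} → d ∣ p ^ e → d ∈ map (p ^_) (upTo (suc e))
    ∣⇒∈powers d∣p^e with ∣p^e⇒≡p^i p-prime e d∣p^e
    ... | i , i≤e , refl = ∈-map⁺ (p ^_) (∈-upTo⁺ (s≤s i≤e))

  ^-distribʳ-* : ∀ a b k → (a * b) ^ k ≡ a ^ k * b ^ k
  ^-distribʳ-* a b zero    = refl
  ^-distribʳ-* a b (suc k) = begin
    a * b * (a * b) ^ k       ≡⟨ cong (a * b *_) (^-distribʳ-* a b k) ⟩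
    a * b * (a ^ k * b ^ k)   ≡⟨ interchange a b (a ^ k) (b ^ k) ⟩
    a * a ^ k * (b * b ^ k)   ∎
    where
    open ≡-Reasoning
    interchange : ∀ w x y z → w * x * (y * z) ≡ w * y * (x * z)
    interchange = solve-∀

  n<2^n : ∀ n → n < 2 ^ n
  n<2^n zero    = s≤s z≤n
  n<2^n (suc n) = +-mono-≤-< (m^n>0 2 n) (subst (n <_) (sym (+-identityʳ (2 ^ n))) (n<2^n n))

  [1+e]^k≤[2^k]^e : ∀ k e → suc e ^ k ≤ (2 ^ k) ^ e
  [1+e]^k≤[2^k]^e k e = begin
    suc e ^ k       ≤⟨ ^-monoˡ-≤ k (n<2^n e) ⟩
    (2 ^ e) ^ k     ≡⟨ ^-*-assoc 2 e k ⟩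
    2 ^ (e * k)     ≡⟨ cong (2 ^_) (*-comm e k) ⟩
    2 ^ (k * e)     ≡⟨ ^-*-assoc 2 k e ⟨
    (2 ^ k) ^ e     ∎
    where open ≤-Reasoning

  -- Write e = a k + r with r < k, so that 1 + e ≤ (1 + a) k ≤ 2^a k.
  [1+e]^k≤k^k*2^e : ∀ k e .{{_ : NonZero k}} → suc e ^ k ≤ k ^ k * 2 ^ e
  [1+e]^k≤k^k*2^e k e = begin
    suc e ^ k            ≤⟨ ^-monoˡ-≤ k 1+e≤[1+a]*k ⟩
    (suc a * k) ^ k      ≡⟨ ^-distribʳ-* (suc a) k k ⟩
    suc a ^ k * k ^ k    ≤⟨ *-monoˡ-≤ (k ^ k) (^-monoˡ-≤ k (n<2^n a)) ⟩
    (2 ^ a) ^ k * k ^ k  ≡⟨ cong (_* k ^ k) (^-*-assoc 2 a k) ⟩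
    2 ^ (a * k) * k ^ k  ≤⟨ *-monoˡ-≤ (k ^ k) (^-monoʳ-≤ 2 a*k≤e) ⟩
    2 ^ e * k ^ k        ≡⟨ *-comm (2 ^ e) (k ^ k) ⟩
    k ^ k * 2 ^ e        ∎
    where
    open ≤-Reasoning
    a : ℕ
    a = e / k
    a*k≤e : a * k ≤ e
    a*k≤e = subst (a * k ≤_) (sym (m≡m%n+[m/n]*n e k)) (m≤n+m (a * k) (e % k))
    1+e≤[1+a]*k : suc e ≤ suc a * k
    1+e≤[1+a]*k = subst (λ x → suc x ≤ suc a * k) (sym (m≡m%n+[m/n]*n e k))
                    (+-monoˡ-≤ (a * k) (m%n<n e k))

  local-factor-bound : ∀ k .{{_ : NonZero k}} {p} e → 2 ≤ p →
                       suc e ^ k * (k ^ k) ^ (2 ^ k ∸ suc p) ≤ (k ^ k) ^ (2 ^ k ∸ p) * p ^ e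
  local-factor-bound k {p} e 2≤p with p <? 2 ^ k
  ... | yes p<2^k = begin
    suc e ^ k * c ^ X          ≤⟨ *-monoˡ-≤ (c ^ X) ([1+e]^k≤k^k*2^e k e) ⟩
    c * 2 ^ e * c ^ X          ≤⟨ *-monoˡ-≤ (c ^ X) (*-monoʳ-≤ c (^-monoˡ-≤ e 2≤p)) ⟩
    c * p ^ e * c ^ X          ≡⟨ regroup c (p ^ e) (c ^ X) ⟩
    c ^ suc X * p ^ e          ≡⟨ cong (λ x → c ^ x * p ^ e) (sym (+-∸-assoc 1 p<2^k)) ⟩
    c ^ (2 ^ k ∸ p) * p ^ e    ∎
    where
    open ≤-Reasoning
    c X : ℕ
    c = k ^ k
    X = 2 ^ k ∸ suc p
    regroup : ∀ x y z → x * y * z ≡ x * z * y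
    regroup = solve-∀
  ... | no p≮2^k = begin
    suc e ^ k * c ^ (2 ^ k ∸ suc p)  ≡⟨ cong (λ x → suc e ^ k * c ^ x) (m≤n⇒m∸n≡0 (m≤n⇒m≤1+n 2^k≤p)) ⟩
    suc e ^ k * 1                    ≡⟨ *-identityʳ (suc e ^ k) ⟩
    suc e ^ k                        ≤⟨ [1+e]^k≤[2^k]^e k e ⟩
    (2 ^ k) ^ e                      ≤⟨ ^-monoˡ-≤ e 2^k≤p ⟩
    p ^ e                            ≡⟨ *-identityˡ (p ^ e) ⟨
    1 * p ^ e                        ≡⟨ cong (λ x → c ^ x * p ^ e) (m≤n⇒m∸n≡0 2^k≤p) ⟨
    c ^ (2 ^ k ∸ p) * p ^ e          ∎
    where
    open ≤-Reasoning
    c : ℕ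
    c = k ^ k
    2^k≤p : 2 ^ k ≤ p
    2^k≤p = ≮⇒≥ p≮2^k

  rough⇒∃-least-divisor : ∀ {B N} .{{_ : NonTrivial N}} → B Rough N → ∃ λ p → B ≤ p × p ∣ N × p Rough N
  rough⇒∃-least-divisor {B} {N} = search N (m≤m+n N B)
    where
    search : ∀ t {B} → N ≤ t + B → B Rough N → ∃ λ p → B ≤ p × p ∣ N × p Rough N
    search t {B} N≤t+B r with B ∣? N
    ... | yes B∣N = B , ≤-refl , B∣N , r
    search zero    N≤B r | no B∤N = contradiction (subst (_∣ N) (≤-antisym N≤B (rough⇒≤ r)) ∣-refl) B∤N
    search (suc t) {B} N≤1+t+B r | no B∤N
      with p , 1+B≤p , p∣N , p-rough ← search t (subst (N ≤_) (sym (+-suc t B)) N≤1+t+B) (∤⇒rough-suc B∤N r)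
      = p , <⇒≤ 1+B≤p , p∣N , p-rough

  p-adic-split : ∀ {p} → 1 < p → ∀ n .{{_ : NonZero n}} → ∃₂ λ e m → n ≡ p ^ e * m × p ∤ m
  p-adic-split {p} 1<p n = split n (<-wellFounded n)
    where
    split : ∀ n .{{_ : NonZero n}} → Acc _<_ n → ∃₂ λ e m → n ≡ p ^ e * m × p ∤ m
    split n (acc rec) with p ∣? n
    ... | no p∤n = 0 , n , sym (*-identityˡ n) , p∤n
    ... | yes (divides m refl)
      with e , m′ , m≡p^e*m′ , p∤m′ ← split m {{m*n≢0⇒m≢0 m}} (rec (m<m*n m p {{m*n≢0⇒m≢0 m}} 1<p))
      = suc e , m′ , trans (cong (_* p) m≡p^e*m′) (rotate p (p ^ e) m′) , p∤m′
      where
      rotate : ∀ x y z → y * z * x ≡ x * y * z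
      rotate = solve-∀

  τ[p^e*m]≤[1+e]*τ[m] : ∀ {p} → Prime p → ∀ e m .{{_ : NonZero m}} → τ (p ^ e * m) ≤ suc e * τ m
  τ[p^e*m]≤[1+e]*τ[m] {p} p-prime e m = begin
    τ (p ^ e * m)       ≤⟨ τ-submultiplicative (p ^ e) m {{m^n≢0 p e {{prime⇒nonZero p-prime}}}} ⟩
    τ (p ^ e) * τ m     ≤⟨ *-monoˡ-≤ (τ m) (τ[p^e]≤1+e p-prime e) ⟩
    suc e * τ m         ∎
    where open ≤-Reasoning

  -- Induction on N, splitting off its least prime factor p: N = p^E m with m (p+1)-rough.
  -- The factor (1 + E)^k is at most p^E once p ≥ 2^k, and at most k^k p^E otherwise; the
  -- exponent 2^k ∸ B bounds how many primes below 2^k a B-rough N can still have.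
  τ^k≤-rough : ∀ k .{{_ : NonZero k}} N .{{_ : NonZero N}} {B} → 2 ≤ B → B Rough N →
               τ N ^ k ≤ (k ^ k) ^ (2 ^ k ∸ B) * N
  τ^k≤-rough k N = go N (<-wellFounded N)
    where
    c : ℕ
    c = k ^ k
    instance
      c≢0 : NonZero c
      c≢0 = m^n≢0 k k

    go : ∀ N .{{_ : NonZero N}} {B} → Acc _<_ N → 2 ≤ B → B Rough N → τ N ^ k ≤ c ^ (2 ^ k ∸ B) * N
    go 1 {B} _ _ _ = begin
      τ 1 ^ k                ≡⟨ ^-zeroˡ k ⟩
      1                      ≤⟨ m^n>0 c (2 ^ k ∸ B) ⟩
      c ^ (2 ^ k ∸ B)        ≡⟨ *-identityʳ _ ⟨
      c ^ (2 ^ k ∸ B) * 1    ∎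
      where open ≤-Reasoning
    go N@(suc (suc _)) {B} (acc rec) 2≤B B-rough
      with p , B≤p , p∣N , p-rough ← rough⇒∃-least-divisor B-rough
      with p-adic-split (≤-trans 2≤B B≤p) N
    ... | zero , m , N≡m , p∤m = contradiction (subst (p ∣_) (trans N≡m (*-identityˡ m)) p∣N) p∤m
    ... | E@(suc _) , m , N≡p^E*m , p∤m = begin
      τ N ^ k                          ≡⟨ cong (λ x → τ x ^ k) N≡p^E*m ⟩
      τ (p ^ E * m) ^ k                ≤⟨ ^-monoˡ-≤ k (τ[p^e*m]≤[1+e]*τ[m] p-prime E m) ⟩
      (suc E * τ m) ^ k                ≡⟨ ^-distribʳ-* (suc E) (τ m) k ⟩
      suc E ^ k * τ m ^ k              ≤⟨ *-monoʳ-≤ (suc E ^ k) (go m (rec m<N) (m≤n⇒m≤1+n 2≤p) m-rough) ⟩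
      suc E ^ k * (c ^ X * m)          ≡⟨ *-assoc (suc E ^ k) (c ^ X) m ⟨
      suc E ^ k * c ^ X * m            ≤⟨ *-monoˡ-≤ m (local-factor-bound k E 2≤p) ⟩
      c ^ (2 ^ k ∸ p) * p ^ E * m      ≡⟨ *-assoc (c ^ (2 ^ k ∸ p)) (p ^ E) m ⟩
      c ^ (2 ^ k ∸ p) * (p ^ E * m)    ≡⟨ cong (c ^ (2 ^ k ∸ p) *_) N≡p^E*m ⟨
      c ^ (2 ^ k ∸ p) * N              ≤⟨ *-monoˡ-≤ N (^-monoʳ-≤ c (∸-monoʳ-≤ (2 ^ k) B≤p)) ⟩
      c ^ (2 ^ k ∸ B) * N              ∎
      where
      open ≤-Reasoning
      X : ℕ
      X = 2 ^ k ∸ suc p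
      2≤p : 2 ≤ p
      2≤p = ≤-trans 2≤B B≤p
      p-prime : Prime p
      p-prime = rough∧∣⇒prime {{n>1⇒nonTrivial 2≤p}} p-rough p∣N
      instance
        m≢0 : NonZero m
        m≢0 = m*n≢0⇒n≢0 (p ^ E) {{subst NonZero N≡p^E*m _}}
      m<N : m < N
      m<N = subst (m <_) (trans (*-comm m (p ^ E)) (sym N≡p^E*m)) (m<m*n m (p ^ E) 1<p^E)
        where
        1<p^E : 1 < p ^ E
        1<p^E = ≤-trans 2≤p
          (subst (_≤ p ^ E) (*-identityʳ p) (^-monoʳ-≤ p {{prime⇒nonZero p-prime}} {1} {E} (s≤s z≤n)))
      m-rough : suc p Rough m
      m-rough = ∤⇒rough-suc p∤m (rough∧∣⇒rough p-rough (divides (p ^ E) N≡p^E*m))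

module DivisorBound where

  open Divisors
  open import Defs using (logRatio)
  open import Data.Nat
    using (ℕ; zero; suc; _+_; _*_; _^_; _∸_; _≤_; _<_; z≤n; s≤s; NonZero; _/_; _%_; _<?_; >-nonZero; ⌊_/2⌋; ⌈_/2⌉)
  open import Data.Nat.Properties
  open import Data.Nat.DivMod using (m≡m%n+[m/n]*n; m%n<n; m*n/n≡m; /-monoˡ-≤)
  open import Data.Nat.Induction using (<-wellFounded)
  open import Data.Nat.Logarithm
    using (⌊log₂_⌋; ⌊log₂⌋-mono-≤; ⌊log₂⌊n/2⌋⌋≡⌊log₂n⌋∸1; ⌊log₂[2^n]⌋≡n)
  open import Data.Nat.Primality using (2-rough)
  open import Data.Nat.Tactic.RingSolver using (solve-∀)
  open import Data.Product using (∃; _×_; _,_)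
  open import Induction.WellFounded using (Acc; acc)
  open import Relation.Binary.PropositionalEquality using (_≡_; refl; sym; trans; cong; subst)
  open import Relation.Nullary using (yes; no)

  n<2^[1+⌊log₂n⌋] : ∀ n → n < 2 ^ suc ⌊log₂ n ⌋
  n<2^[1+⌊log₂n⌋] n = ≰⇒> λ 2^[1+ℓ]≤n →
    <-irrefl refl (subst (_≤ ⌊log₂ n ⌋) (⌊log₂[2^n]⌋≡n (suc ⌊log₂ n ⌋)) (⌊log₂⌋-mono-≤ 2^[1+ℓ]≤n))

  2^⌊log₂n⌋≤n : ∀ n .{{_ : NonZero n}} → 2 ^ ⌊log₂ n ⌋ ≤ n
  2^⌊log₂n⌋≤n n = go n (<-wellFounded n)
    where
    go : ∀ n .{{_ : NonZero n}} → Acc _<_ n → 2 ^ ⌊log₂ n ⌋ ≤ n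
    go 1 _ = ≤-refl
    go n@(suc (suc k)) (acc rec) = begin
      2 ^ ⌊log₂ n ⌋                  ≡⟨ cong (2 ^_) (m+[n∸m]≡n 1≤⌊log₂n⌋) ⟨
      2 * 2 ^ (⌊log₂ n ⌋ ∸ 1)        ≡⟨ cong (λ e → 2 * 2 ^ e) (⌊log₂⌊n/2⌋⌋≡⌊log₂n⌋∸1 n) ⟨
      2 * 2 ^ ⌊log₂ ⌊ n /2⌋ ⌋        ≤⟨ *-monoʳ-≤ 2 (go ⌊ n /2⌋ (rec (⌊n/2⌋<n (suc k)))) ⟩
      ⌊ n /2⌋ + (⌊ n /2⌋ + 0)        ≡⟨ cong (⌊ n /2⌋ +_) (+-identityʳ ⌊ n /2⌋) ⟩
      ⌊ n /2⌋ + ⌊ n /2⌋              ≤⟨ +-monoʳ-≤ ⌊ n /2⌋ (⌊n/2⌋≤⌈n/2⌉ n) ⟩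
      ⌊ n /2⌋ + ⌈ n /2⌉              ≡⟨ ⌊n/2⌋+⌈n/2⌉≡n n ⟩
      n                              ∎
      where
      open ≤-Reasoning
      1≤⌊log₂n⌋ : 1 ≤ ⌊log₂ n ⌋
      1≤⌊log₂n⌋ = ⌊log₂⌋-mono-≤ {2} {n} (s≤s (s≤s z≤n))

  m*n≤o⇒m≤o/n : ∀ m n {o} .{{_ : NonZero n}} → m * n ≤ o → m ≤ o / n
  m*n≤o⇒m≤o/n m n m*n≤o = subst (_≤ _) (m*n/n≡m m n) (/-monoˡ-≤ n m*n≤o)

  m<[1+m/n]*n : ∀ m n .{{_ : NonZero n}} → m < suc (m / n) * n
  m<[1+m/n]*n m n = subst (_< suc (m / n) * n) (sym (m≡m%n+[m/n]*n m n))
                      (+-monoˡ-< ((m / n) * n) (m%n<n m n))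

  τ^k≤2^[k*4^k]*N : ∀ k .{{_ : NonZero k}} N .{{_ : NonZero N}} → τ N ^ k ≤ 2 ^ (k * 4 ^ k) * N
  τ^k≤2^[k*4^k]*N k N = begin
    τ N ^ k                       ≤⟨ τ^k≤-rough k N ≤-refl 2-rough ⟩
    (k ^ k) ^ (2 ^ k ∸ 2) * N     ≤⟨ *-monoˡ-≤ N (^-monoʳ-≤ (k ^ k) {{m^n≢0 k k}} (m∸n≤m (2 ^ k) 2)) ⟩
    (k ^ k) ^ (2 ^ k) * N         ≤⟨ *-monoˡ-≤ N (^-monoˡ-≤ (2 ^ k) (^-monoˡ-≤ k (<⇒≤ (n<2^n k)))) ⟩
    ((2 ^ k) ^ k) ^ (2 ^ k) * N   ≡⟨ cong (_* N) (trans (cong (_^ 2 ^ k) (^-*-assoc 2 k k)) (^-*-assoc 2 (k * k) (2 ^ k))) ⟩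
    2 ^ (k * k * 2 ^ k) * N       ≤⟨ *-monoˡ-≤ N (^-monoʳ-≤ 2 k*k*2^k≤k*4^k) ⟩
    2 ^ (k * 4 ^ k) * N           ∎
    where
    open ≤-Reasoning
    k*k*2^k≤k*4^k : k * k * 2 ^ k ≤ k * 4 ^ k
    k*k*2^k≤k*4^k = begin
      k * k * 2 ^ k         ≡⟨ *-assoc k k (2 ^ k) ⟩
      k * (k * 2 ^ k)       ≤⟨ *-monoʳ-≤ k (*-monoˡ-≤ (2 ^ k) (<⇒≤ (n<2^n k))) ⟩
      k * (2 ^ k * 2 ^ k)   ≡⟨ cong (k *_) (^-distribʳ-* 2 2 k) ⟨
      k * 4 ^ k             ∎

  τ<2^ : ∀ k .{{_ : NonZero k}} N .{{_ : NonZero N}} {m E} → N < 2 ^ m → k * 4 ^ k + m ≤ k * E → τ N < 2 ^ E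
  τ<2^ k N {m} {E} N<2^m exponent≤ = ≰⇒> λ 2^E≤τN → <⇒≱ τN^k<[2^E]^k (^-monoˡ-≤ k 2^E≤τN)
    where
    open ≤-Reasoning
    τN^k<[2^E]^k : τ N ^ k < (2 ^ E) ^ k
    τN^k<[2^E]^k = begin-strict
      τ N ^ k                    ≤⟨ τ^k≤2^[k*4^k]*N k N ⟩
      2 ^ (k * 4 ^ k) * N        <⟨ *-monoʳ-< (2 ^ (k * 4 ^ k)) {{m^n≢0 2 (k * 4 ^ k)}} N<2^m ⟩
      2 ^ (k * 4 ^ k) * 2 ^ m    ≡⟨ ^-distribˡ-+-* 2 (k * 4 ^ k) m ⟨
      2 ^ (k * 4 ^ k + m)        ≤⟨ ^-monoʳ-≤ 2 exponent≤ ⟩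
      2 ^ (k * E)                ≡⟨ cong (2 ^_) (*-comm k E) ⟩
      2 ^ (E * k)                ≡⟨ ^-*-assoc 2 E k ⟨
      (2 ^ E) ^ k                ∎

  1+4k≤4^k : ∀ k → 2 ≤ k → suc (4 * k) ≤ 4 ^ k
  1+4k≤4^k 1 (s≤s ())
  1+4k≤4^k 2 _ = m≤m+n 9 7
  1+4k≤4^k (suc k@(suc (suc _))) _ = begin
    suc (4 * suc k)     ≡⟨ cong suc (*-suc 4 k) ⟩
    4 + suc (4 * k)     ≤⟨ +-mono-≤ 4≤4^k (1+4k≤4^k k (s≤s (s≤s z≤n))) ⟩
    4 ^ k + 4 ^ k       ≤⟨ +-monoʳ-≤ (4 ^ k) (m≤m+n (4 ^ k) (4 ^ k + (4 ^ k + 0))) ⟩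
    4 * 4 ^ k           ∎
    where
    open ≤-Reasoning
    4≤4^k : 4 ≤ 4 ^ k
    4≤4^k = ^-monoʳ-≤ 4 {1} {k} (s≤s z≤n)

  -- With m = r + 4k (r < 4): 1 + m ≤ 2^r (1 + 4k) ≤ 2^r 4^k, and 4^k 2^r 4^k = 2^(r + 4k).
  4^[m/4]*[1+m]≤2^m : ∀ m → 8 ≤ m → 4 ^ (m / 4) * suc m ≤ 2 ^ m
  4^[m/4]*[1+m]≤2^m m 8≤m = begin
    4 ^ k * suc m              ≡⟨ cong (λ x → 4 ^ k * suc x) m≡r+k*4 ⟩
    4 ^ k * suc (r + k * 4)    ≤⟨ *-monoʳ-≤ (4 ^ k) 1+m≤2^r*4^k ⟩
    4 ^ k * (2 ^ r * 4 ^ k)    ≡⟨ regroup (4 ^ k) (2 ^ r) ⟩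
    2 ^ r * (4 ^ k * 4 ^ k)    ≡⟨ cong (2 ^ r *_) (trans (sym (^-*-assoc 2 4 k)) (^-distribʳ-* 4 4 k)) ⟨
    2 ^ r * 2 ^ (4 * k)        ≡⟨ ^-distribˡ-+-* 2 r (4 * k) ⟨
    2 ^ (r + 4 * k)            ≡⟨ cong (λ x → 2 ^ (r + x)) (*-comm 4 k) ⟩
    2 ^ (r + k * 4)            ≡⟨ cong (2 ^_) m≡r+k*4 ⟨
    2 ^ m                      ∎
    where
    open ≤-Reasoning
    k r : ℕ
    k = m / 4
    r = m % 4
    m≡r+k*4 : m ≡ r + k * 4
    m≡r+k*4 = m≡m%n+[m/n]*n m 4
    regroup : ∀ x y → x * (y * x) ≡ y * (x * x)
    regroup = solve-∀
    1+m≤2^r*4^k : suc (r + k * 4) ≤ 2 ^ r * 4 ^ k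
    1+m≤2^r*4^k = begin
      suc r + k * 4              ≤⟨ +-mono-≤ (n<2^n r) (≤-reflexive (*-comm k 4)) ⟩
      2 ^ r + 4 * k              ≤⟨ +-monoʳ-≤ (2 ^ r) (m≤n*m (4 * k) (2 ^ r) {{m^n≢0 2 r}}) ⟩
      2 ^ r + 2 ^ r * (4 * k)    ≡⟨ *-suc (2 ^ r) (4 * k) ⟨
      2 ^ r * suc (4 * k)        ≤⟨ *-monoʳ-≤ (2 ^ r) (1+4k≤4^k k (m*n≤o⇒m≤o/n 2 4 8≤m)) ⟩
      2 ^ r * 4 ^ k              ∎

  -- k = ⌊log₂ ℓ⌋ / 4 makes the cost k 4^k of τ^k≤2^[k*4^k]*N at most k L, with L = ℓ / (1 + ⌊log₂ ℓ⌋),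
  -- while 1 + ℓ ≤ 16 k L.
  ∃-balancing-k : ∀ ℓ .{{_ : NonZero ℓ}} → 8 ≤ ⌊log₂ ℓ ⌋ →
                         ∃ λ k → 1 ≤ k × k * 4 ^ k + (suc ℓ + suc ℓ) ≤ k * (33 * (ℓ / suc ⌊log₂ ℓ ⌋))
  ∃-balancing-k ℓ 8≤m = k , 1≤k , (begin
    k * 4 ^ k + (suc ℓ + suc ℓ)                      ≤⟨ +-mono-≤ (*-monoʳ-≤ k 4^k≤L) (+-mono-≤ 1+ℓ≤16kL 1+ℓ≤16kL) ⟩
    k * L + ((L + L) * (8 * k) + (L + L) * (8 * k))  ≡⟨ collect k L ⟩
    k * (33 * L)                                     ∎)
    where
    open ≤-Reasoning
    m k L : ℕ
    m = ⌊log₂ ℓ ⌋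
    k = m / 4
    L = ℓ / suc m
    collect : ∀ k L → k * L + ((L + L) * (8 * k) + (L + L) * (8 * k)) ≡ k * (33 * L)
    collect = solve-∀
    1≤k : 1 ≤ k
    1≤k = m*n≤o⇒m≤o/n 1 4 (≤-trans (m≤m+n 4 4) 8≤m)
    4^k≤L : 4 ^ k ≤ L
    4^k≤L = m*n≤o⇒m≤o/n (4 ^ k) (suc m) (≤-trans (4^[m/4]*[1+m]≤2^m m 8≤m) (2^⌊log₂n⌋≤n ℓ))
    1+m≤8k : suc m ≤ 8 * k
    1+m≤8k = begin
      suc m                ≡⟨ cong suc (m≡m%n+[m/n]*n m 4) ⟩
      suc (m % 4) + k * 4  ≤⟨ +-mono-≤ (m%n<n m 4) (≤-reflexive (*-comm k 4)) ⟩
      4 + 4 * k            ≤⟨ +-monoˡ-≤ (4 * k) (*-monoʳ-≤ 4 1≤k) ⟩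
      4 * k + 4 * k        ≡⟨ *-distribʳ-+ k 4 4 ⟨
      8 * k                ∎
    1+ℓ≤16kL : suc ℓ ≤ (L + L) * (8 * k)
    1+ℓ≤16kL = begin
      suc ℓ                ≤⟨ m<[1+m/n]*n ℓ (suc m) ⟩
      suc L * suc m        ≤⟨ *-mono-≤ (+-monoˡ-≤ L (≤-trans (m^n>0 4 k) 4^k≤L)) 1+m≤8k ⟩
      (L + L) * (8 * k)    ∎

  n*n<2^[2+2⌊log₂n⌋] : ∀ n → n * n < 2 ^ (suc ⌊log₂ n ⌋ + suc ⌊log₂ n ⌋)
  n*n<2^[2+2⌊log₂n⌋] n = subst (n * n <_) (sym (^-distribˡ-+-* 2 (suc ⌊log₂ n ⌋) (suc ⌊log₂ n ⌋)))
                          (*-mono-< (n<2^[1+⌊log₂n⌋] n) (n<2^[1+⌊log₂n⌋] n))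

  1≤logRatio : ∀ q → 2 ≤ q → 1 ≤ logRatio q
  1≤logRatio q 2≤q = m*n≤o⇒m≤o/n 1 (suc m) (≤-trans (≤-reflexive (*-identityˡ (suc m))) 1+m≤ℓ)
    where
    ℓ m : ℕ
    ℓ = ⌊log₂ q ⌋
    m = ⌊log₂ ℓ ⌋
    1+m≤ℓ : suc m ≤ ℓ
    1+m≤ℓ = ≤-trans (n<2^n m) (2^⌊log₂n⌋≤n ℓ {{>-nonZero (⌊log₂⌋-mono-≤ 2≤q)}})

  module _ (q : ℕ) (2≤q : 2 ≤ q) N .{{_ : NonZero N}} (N<q*q : N < q * q) where
    private
      ℓ L : ℕ
      ℓ = ⌊log₂ q ⌋
      L = logRatio q
      N<2^[2+2ℓ] : N < 2 ^ (suc ℓ + suc ℓ)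
      N<2^[2+2ℓ] = <-trans N<q*q (n*n<2^[2+2⌊log₂n⌋] q)

    τ-bound-small : ⌊log₂ ℓ ⌋ < 8 → τ N ≤ 2 ^ (512 * L)
    τ-bound-small m<8 = begin
      τ N                    ≤⟨ τ[n]≤1+n N ⟩
      suc N                  ≤⟨ N<2^[2+2ℓ] ⟩
      2 ^ (suc ℓ + suc ℓ)    ≤⟨ ^-monoʳ-≤ 2 (≤-trans (+-mono-≤ 1+ℓ≤256 1+ℓ≤256) 512≤512L) ⟩
      2 ^ (512 * L)          ∎
      where
      open ≤-Reasoning
      1+ℓ≤256 : suc ℓ ≤ 256
      1+ℓ≤256 = ≤-trans (n<2^[1+⌊log₂n⌋] ℓ) (^-monoʳ-≤ 2 m<8)
      512≤512L : 512 ≤ 512 * L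
      512≤512L = *-monoʳ-≤ 512 (1≤logRatio q 2≤q)

    τ-bound-large : 8 ≤ ⌊log₂ ℓ ⌋ → τ N ≤ 2 ^ (512 * L)
    τ-bound-large 8≤m = large (∃-balancing-k ℓ {{>-nonZero (⌊log₂⌋-mono-≤ 2≤q)}} 8≤m)
      where
      open ≤-Reasoning
      large : (∃ λ k → 1 ≤ k × k * 4 ^ k + (suc ℓ + suc ℓ) ≤ k * (33 * L)) → τ N ≤ 2 ^ (512 * L)
      large (k , 1≤k , balanced) = begin
        τ N              ≤⟨ <⇒≤ (τ<2^ k {{>-nonZero 1≤k}} N N<2^[2+2ℓ] balanced) ⟩
        2 ^ (33 * L)     ≤⟨ ^-monoʳ-≤ 2 (*-monoˡ-≤ L (m≤m+n 33 479)) ⟩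
        2 ^ (512 * L)    ∎

  τ-bound : ∀ q → 2 ≤ q → ∀ N → N < q * q → τ N ≤ 2 ^ (512 * logRatio q)
  τ-bound q 2≤q zero    _ = m^n>0 2 (512 * logRatio q)
  τ-bound q 2≤q N@(suc _) N<q*q with ⌊log₂ ⌊log₂ q ⌋ ⌋ <? 8
  ... | yes m<8 = τ-bound-small q 2≤q N N<q*q m<8
  ... | no  m≮8 = τ-bound-large q 2≤q N N<q*q (≮⇒≥ m≮8)

module Congruences where

  open import Data.Nat as ℕ using (ℕ; zero; suc; NonZero; nonTrivial⇒≢1)
  import Data.Nat.Properties as ℕ
  open import Data.Nat.DivMod using (m≡m%n+[m/n]*n; m%n<n)
  open import Data.Nat.Divisibility as ℕ∣ using (>⇒∤)
  open import Data.Nat.Primality using (Prime; euclidsLemma; prime⇒nonTrivial)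
  open import Data.Integer using (ℤ; +_; -[1+_]; -_; _+_; _-_; _*_; _^_; ∣_∣; 0ℤ; 1ℤ)
  open import Data.Integer.Properties
    using (+-inverseʳ; abs-*; pos-+; pos-*; [+m]-[+n]≡m⊖n; ∣⊖∣-≤; ∣m⊖n∣≡∣n⊖m∣)
  open import Data.Integer.Divisibility.Signed
    using (_∣_; _∣?_; divides; ∣m⇒∣-m; ∣ᵤ⇒∣; ∣⇒∣ᵤ; ∣m∣n⇒∣m+n; ∣m∣n⇒∣m-n; ∣m⇒∣m*n; ∣n⇒∣m*n)
  open import Data.Integer.Tactic.RingSolver using (solve-∀)
  open import Data.Sum using (_⊎_; inj₁; inj₂)
  open import Relation.Binary.Bundles using (Setoid)
  open import Relation.Binary.PropositionalEquality
    using (_≡_; refl; sym; trans; cong; cong₂; subst; module ≡-Reasoning)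
  import Relation.Binary.Reasoning.Setoid as SetoidReasoning
  open import Relation.Nullary using (¬_; Dec)
  import Relation.Nullary.Decidable as Dec
  open import Relation.Nullary.Negation using (contradiction)

  infix 4 _≡_mod_

  -- A record rather than a synonym for + q ∣ x - y, so that x and y can be inferred from it.
  record _≡_mod_ (x y : ℤ) (q : ℕ) : Set where
    constructor mod-divides
    field divides-difference : + q ∣ x - y

  module _ {q : ℕ} where

    ≡⇒≡-mod : ∀ {x y} → x ≡ y → x ≡ y mod q
    ≡⇒≡-mod {x} refl = mod-divides (divides 0ℤ (+-inverseʳ x))

    ≡-mod-sym : ∀ {x y} → x ≡ y mod q → y ≡ x mod q
    ≡-mod-sym {x} {y} (mod-divides q∣x-y) = mod-divides (subst (+ q ∣_) (negate x y) (∣m⇒∣-m q∣x-y))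
      where
      negate : ∀ x y → - (x - y) ≡ y - x
      negate = solve-∀

    ≡-mod-trans : ∀ {x y z} → x ≡ y mod q → y ≡ z mod q → x ≡ z mod q
    ≡-mod-trans {x} {y} {z} (mod-divides q∣x-y) (mod-divides q∣y-z) =
      mod-divides (subst (+ q ∣_) (telescope x y z) (∣m∣n⇒∣m+n q∣x-y q∣y-z))
      where
      telescope : ∀ x y z → (x - y) + (y - z) ≡ x - z
      telescope = solve-∀

    *-cong-mod : ∀ {a b c d} → a ≡ b mod q → c ≡ d mod q → a * c ≡ b * d mod q
    *-cong-mod {a} {b} {c} {d} (mod-divides q∣a-b) (mod-divides q∣c-d) =
      mod-divides (subst (+ q ∣_) (expand a b c d) (∣m∣n⇒∣m+n (∣m⇒∣m*n c q∣a-b) (∣n⇒∣m*n b q∣c-d)))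
      where
      expand : ∀ a b c d → (a - b) * c + b * (c - d) ≡ a * c - b * d
      expand = solve-∀

    *-congˡ-mod : ∀ a {b c} → b ≡ c mod q → a * b ≡ a * c mod q
    *-congˡ-mod a = *-cong-mod (≡⇒≡-mod {a} refl)

  ≡-mod-setoid : ℕ → Setoid _ _
  ≡-mod-setoid q = record
    { Carrier       = ℤ
    ; _≈_           = _≡_mod q
    ; isEquivalence = record
      { refl  = λ {x} → ≡⇒≡-mod {q} {x} refl
      ; sym   = λ {x} {y} → ≡-mod-sym {q} {x} {y}
      ; trans = λ {x} {y} {z} → ≡-mod-trans {q} {x} {y} {z}
      }
    }

  module _ {q : ℕ} (q-prime : Prime q) where

    ∣*⇒∣⊎∣ : ∀ a b → + q ∣ a * b → (+ q ∣ a) ⊎ (+ q ∣ b)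
    ∣*⇒∣⊎∣ a b q∣ab
      with euclidsLemma ∣ a ∣ ∣ b ∣ q-prime (subst (q ℕ∣.∣_) (abs-* a b) (∣⇒∣ᵤ q∣ab))
    ... | inj₁ q∣a = inj₁ (∣ᵤ⇒∣ q∣a)
    ... | inj₂ q∣b = inj₂ (∣ᵤ⇒∣ q∣b)

    ∤*∤ : ∀ {a b} → ¬ (+ q ∣ a) → ¬ (+ q ∣ b) → ¬ (+ q ∣ a * b)
    ∤*∤ {a} {b} q∤a q∤b q∣ab with ∣*⇒∣⊎∣ a b q∣ab
    ... | inj₁ q∣a = q∤a q∣a
    ... | inj₂ q∣b = q∤b q∣b

    ∤^ : ∀ {a} → ¬ (+ q ∣ a) → ∀ e → ¬ (+ q ∣ a ^ e)
    ∤^ q∤a zero    q∣1 = nonTrivial⇒≢1 {{prime⇒nonTrivial q-prime}} (ℕ∣.∣1⇒≡1 (∣⇒∣ᵤ q∣1))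
    ∤^ q∤a (suc e) = ∤*∤ q∤a (∤^ q∤a e)

    *-cancelˡ-≡-mod : ∀ {c x y} → ¬ (+ q ∣ c) → c * x ≡ c * y mod q → x ≡ y mod q
    *-cancelˡ-≡-mod {c} {x} {y} q∤c (mod-divides q∣cx-cy)
      with ∣*⇒∣⊎∣ c (x - y) (subst (+ q ∣_) (factor c x y) q∣cx-cy)
      where
      factor : ∀ c x y → c * x - c * y ≡ c * (x - y)
      factor = solve-∀
    ... | inj₁ q∣c   = contradiction q∣c q∤c
    ... | inj₂ q∣x-y = mod-divides q∣x-y

  ≡-mod-∤ : ∀ {q x y} → x ≡ y mod q → ¬ (+ q ∣ y) → ¬ (+ q ∣ x)
  ≡-mod-∤ {q} {x} {y} (mod-divides q∣x-y) q∤y q∣x =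
    q∤y (subst (+ q ∣_) (x-[x-y]≡y x y) (∣m∣n⇒∣m-n q∣x q∣x-y))
    where
    x-[x-y]≡y : ∀ x y → x - (x - y) ≡ y
    x-[x-y]≡y = solve-∀

  0<s<q⇒∤ : ∀ {q s} → 0 ℕ.< s → s ℕ.< q → ¬ (+ q ∣ + s)
  0<s<q⇒∤ {s = suc _} _ s<q q∣s = >⇒∤ s<q (∣⇒∣ᵤ q∣s)

  ≡-mod⇒≡ : ∀ {q u u′} → u ℕ.< q → u′ ℕ.< q → + u ≡ + u′ mod q → u ≡ u′
  ≡-mod⇒≡ {q} {u} {u′} u<q u′<q (mod-divides q∣u-u′) =
    ℕ.∣m-n∣≡0⇒m≡n (multiple<q⇒≡0 (subst (q ℕ∣.∣_) distance (∣⇒∣ᵤ q∣u-u′)))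
    where
    distance : ∣ + u - + u′ ∣ ≡ ℕ.∣ u - u′ ∣
    distance with ℕ.≤-total u u′
    ... | inj₁ u≤u′ = trans (cong ∣_∣ ([+m]-[+n]≡m⊖n u u′))
                        (trans (∣⊖∣-≤ u≤u′) (sym (ℕ.m≤n⇒∣m-n∣≡n∸m u≤u′)))
    ... | inj₂ u′≤u = trans (cong ∣_∣ ([+m]-[+n]≡m⊖n u u′))
                        (trans (∣m⊖n∣≡∣n⊖m∣ u u′)
                          (trans (∣⊖∣-≤ u′≤u) (sym (ℕ.m≤n⇒∣n-m∣≡n∸m u′≤u))))
    multiple<q⇒≡0 : q ℕ∣.∣ ℕ.∣ u - u′ ∣ → ℕ.∣ u - u′ ∣ ≡ 0
    multiple<q⇒≡0 q∣d with ℕ.∣ u - u′ ∣ | ℕ.∣m-n∣≤m⊔n u u′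
    ... | zero  | _     = refl
    ... | suc _ | d≤u⊔u′ = contradiction q∣d (>⇒∤ (ℕ.≤-<-trans d≤u⊔u′ (ℕ.⊔-lub u<q u′<q)))

  +n≡+[n%q] : ∀ n q .{{_ : NonZero q}} → + n ≡ + (n ℕ.% q) mod q
  +n≡+[n%q] n q = mod-divides (divides (+ (n ℕ./ q)) (begin
    + n - + r                        ≡⟨ cong (λ m → + m - + r) (m≡m%n+[m/n]*n n q) ⟩
    + (r ℕ.+ n ℕ./ q ℕ.* q) - + r    ≡⟨ cong (_- + r) (trans (pos-+ r _) (cong (_+_ (+ r)) (pos-* (n ℕ./ q) q))) ⟩
    + r + + (n ℕ./ q) * + q - + r    ≡⟨ cancel (+ r) (+ (n ℕ./ q) * + q) ⟩
    + (n ℕ./ q) * + q                ∎))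
    where
    open ≡-Reasoning
    r : ℕ
    r = n ℕ.% q
    cancel : ∀ a b → a + b - a ≡ b
    cancel = solve-∀

  /-cong∧≡-mod⇒≡ : ∀ {q i i′} .{{_ : NonZero q}} → i ℕ./ q ≡ i′ ℕ./ q → + i ≡ + i′ mod q → i ≡ i′
  /-cong∧≡-mod⇒≡ {q} {i} {i′} i/q≡i′/q i≡i′ = begin
    i                            ≡⟨ m≡m%n+[m/n]*n i q ⟩
    i ℕ.% q ℕ.+ i ℕ./ q ℕ.* q    ≡⟨ cong₂ (λ r d → r ℕ.+ d ℕ.* q) residues≡ i/q≡i′/q ⟩
    i′ ℕ.% q ℕ.+ i′ ℕ./ q ℕ.* q  ≡⟨ m≡m%n+[m/n]*n i′ q ⟨
    i′                           ∎
    where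
    open ≡-Reasoning
    residues≡ : i ℕ.% q ≡ i′ ℕ.% q
    residues≡ = ≡-mod⇒≡ (m%n<n i q) (m%n<n i′ q)
      (≡-mod-trans (≡-mod-sym (+n≡+[n%q] i q)) (≡-mod-trans i≡i′ (+n≡+[n%q] i′ q)))

  -‿cancelʳ-≡-mod : ∀ {q x y} c → x - c ≡ y - c mod q → x ≡ y mod q
  -‿cancelʳ-≡-mod {q} {x} {y} c (mod-divides q∣[x-c]-[y-c]) =
    mod-divides (subst (+ q ∣_) (cancel x y c) q∣[x-c]-[y-c])
    where
    cancel : ∀ x y c → (x - c) - (y - c) ≡ x - y
    cancel = solve-∀

  ≡-mod? : ∀ q x y → Dec (x ≡ y mod q)
  ≡-mod? q x y = Dec.map′ mod-divides _≡_mod_.divides-difference (+ q ∣? x - y)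

  ∤⇒∣∣≢0 : ∀ {q x} → ¬ (+ q ∣ x) → NonZero ∣ x ∣
  ∤⇒∣∣≢0 {x = + zero}   q∤0 = contradiction (divides 0ℤ refl) q∤0
  ∤⇒∣∣≢0 {x = + suc _}  _   = _
  ∤⇒∣∣≢0 {x = -[1+ _ ]} _   = _

  module _ {q : ℕ} where
    open SetoidReasoning (≡-mod-setoid q)

    quadratic-relation : ∀ s a₁ a₂ a₃ u {x₁ x₂ x₃} →
      s * a₁ * u ^ 1 ≡ x₁ mod q → s * a₂ * u ^ 2 ≡ x₂ mod q → s * a₃ * u ^ 3 ≡ x₃ mod q →
      a₂ * a₂ * (x₁ * x₃) ≡ a₁ * a₃ * (x₂ * x₂) mod q
    quadratic-relation s a₁ a₂ a₃ u {x₁} {x₂} {x₃} T₁≡x₁ T₂≡x₂ T₃≡x₃ = begin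
      a₂ * a₂ * (x₁ * x₃)                          ≈⟨ *-congˡ-mod (a₂ * a₂) (*-cong-mod T₁≡x₁ T₃≡x₃) ⟨
      a₂ * a₂ * (s * a₁ * u ^ 1 * (s * a₃ * u ^ 3)) ≡⟨ identity s a₁ a₂ a₃ u ⟩
      a₁ * a₃ * (s * a₂ * u ^ 2 * (s * a₂ * u ^ 2)) ≈⟨ *-congˡ-mod (a₁ * a₃) (*-cong-mod T₂≡x₂ T₂≡x₂) ⟩
      a₁ * a₃ * (x₂ * x₂)                          ∎
      where
      -- ℤ's _^_ is unfolded by hand: u ^ 2 is u * (u * 1ℤ), which the solver cannot see through.
      identity : ∀ s a₁ a₂ a₃ u →
                 a₂ * a₂ * (s * a₁ * (u * 1ℤ) * (s * a₃ * (u * (u * (u * 1ℤ))))) ≡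
                 a₁ * a₃ * (s * a₂ * (u * (u * 1ℤ)) * (s * a₂ * (u * (u * 1ℤ))))
      identity = solve-∀

  module _ {q : ℕ} (q-prime : Prime q) where
    open SetoidReasoning (≡-mod-setoid q)

    two-powers⇒≡-mod : ∀ a₁ a₂ s s′ u u′ →
      ¬ (+ q ∣ a₁) → ¬ (+ q ∣ a₂) → ¬ (+ q ∣ s′) → ¬ (+ q ∣ u′) →
      s * a₁ * u ^ 1 ≡ s′ * a₁ * u′ ^ 1 mod q → s * a₂ * u ^ 2 ≡ s′ * a₂ * u′ ^ 2 mod q → u ≡ u′ mod q
    two-powers⇒≡-mod a₁ a₂ s s′ u u′ q∤a₁ q∤a₂ q∤s′ q∤u′ T₁≡T₁′ T₂≡T₂′ =
      *-cancelˡ-≡-mod q-prime (∤*∤ q-prime q∤s′ q∤u′) (begin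
        s′ * u′ * u        ≈⟨ *-cong-mod su≡s′u′ (≡⇒≡-mod {x = u} refl) ⟨
        s * u * u          ≡⟨ square s u ⟩
        s * (u * u)        ≈⟨ su²≡s′u′² ⟩
        s′ * (u′ * u′)     ≡⟨ square s′ u′ ⟨
        s′ * u′ * u′       ∎)
      where
      square : ∀ s u → s * u * u ≡ s * (u * u)
      square = solve-∀
      linear : ∀ a s u → a * (s * u) ≡ s * a * (u * 1ℤ)
      linear = solve-∀
      quadratic : ∀ a s u → a * (s * (u * u)) ≡ s * a * (u * (u * 1ℤ))
      quadratic = solve-∀
      su≡s′u′ : s * u ≡ s′ * u′ mod q
      su≡s′u′ = *-cancelˡ-≡-mod q-prime q∤a₁ (begin
        a₁ * (s * u)            ≡⟨ linear a₁ s u ⟩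
        s * a₁ * u ^ 1          ≈⟨ T₁≡T₁′ ⟩
        s′ * a₁ * u′ ^ 1        ≡⟨ linear a₁ s′ u′ ⟨
        a₁ * (s′ * u′)          ∎)
      su²≡s′u′² : s * (u * u) ≡ s′ * (u′ * u′) mod q
      su²≡s′u′² = *-cancelˡ-≡-mod q-prime q∤a₂ (begin
        a₂ * (s * (u * u))      ≡⟨ quadratic a₂ s u ⟩
        s * a₂ * u ^ 2          ≈⟨ T₂≡T₂′ ⟩
        s′ * a₂ * u′ ^ 2        ≡⟨ quadratic a₂ s′ u′ ⟨
        a₂ * (s′ * (u′ * u′))   ∎)

module SymmetricRanges where

  open ListCounting
  open Congruences
  open import Data.Nat as ℕ using (ℕ; suc; _+_; _≤_; s≤s; NonZero; _/_)
  open import Data.Nat.Properties as ℕ using (≤-pred; ≤-trans; m∸n≤m; m≤m+n; +-monoˡ-≤; m+[n∸m]≡n)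
  open import Data.Nat.DivMod using (/-monoˡ-≤)
  open import Data.Integer as ℤ using (ℤ; +_; -[1+_]; _-_; ∣_∣)
  open import Data.Integer.Properties using (+-injective; pos-+; [+m]-[+n]≡m⊖n; ∣⊖∣-≤; ∣m⊖n∣≡∣n⊖m∣)
  open import Data.Integer.Tactic.RingSolver using (solve-∀)
  open import Data.List using (List; length; map; upTo)
  open import Data.List.Properties using (length-map; length-upTo)
  open import Data.List.Membership.Propositional using (_∈_)
  open import Data.List.Membership.Propositional.Properties using (∈-map⁺; ∈-map⁻; ∈-upTo⁺; ∈-upTo⁻)
  open import Data.List.Relation.Unary.All using (All)
  open import Data.List.Relation.Unary.Unique.Propositional using (Unique)
  open import Data.List.Relation.Unary.Unique.Propositional.Properties as Unique using (upTo⁺)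
  open import Data.Product using (∃; _×_; _,_; proj₁)
  open import Data.Sum using (inj₁; inj₂)
  open import Relation.Binary.PropositionalEquality using (_≡_; refl; sym; trans; cong; subst)

  symmetricRange : ℕ → List ℤ
  symmetricRange H = map (λ i → + i - + H) (upTo (suc (H + H)))

  length-symmetricRange : ∀ H → length (symmetricRange H) ≡ suc (H + H)
  length-symmetricRange H = trans (length-map _ (upTo (suc (H + H)))) (length-upTo (suc (H + H)))

  symmetricRange-unique : ∀ H → Unique (symmetricRange H)
  symmetricRange-unique H =
    Unique.map⁺ (λ {i} {j} eq → +-injective (subtract-injective (+ i) (+ j) (+ H) eq)) (upTo⁺ _)
    where
    subtract-injective : ∀ x y c → x - c ≡ y - c → x ≡ y
    subtract-injective x y c eq = trans (sym (add-back x c)) (trans (cong (ℤ._+ c) eq) (add-back y c))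
      where
      add-back : ∀ x c → x - c ℤ.+ c ≡ x
      add-back = solve-∀

  ∈-symmetricRange⁺ : ∀ {H} z → ∣ z ∣ ≤ H → z ∈ symmetricRange H
  ∈-symmetricRange⁺ {H} z ∣z∣≤H =
    let i , i≤H+H , i-H≡z = centre z ∣z∣≤H
    in subst (_∈ symmetricRange H) i-H≡z (∈-map⁺ (λ i → + i - + H) (∈-upTo⁺ (s≤s i≤H+H)))
    where
    centre : ∀ z → ∣ z ∣ ≤ H → ∃ λ i → i ≤ H + H × + i - + H ≡ z
    centre (+ n) n≤H = n + H , +-monoˡ-≤ H n≤H , trans (cong (_- + H) (pos-+ n H)) (cancel (+ n) (+ H))
      where
      cancel : ∀ x c → x ℤ.+ c - c ≡ x
      cancel = solve-∀
    centre -[1+ n ] 1+n≤H = t , ≤-trans (m∸n≤m H (suc n)) (m≤m+n H H) ,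
      subst (λ K → + t - + K ≡ -[1+ n ]) (m+[n∸m]≡n 1+n≤H)
        (trans (cong (+ t -_) (pos-+ (suc n) t)) (cancel (+ suc n) (+ t)))
      where
      t : ℕ
      t = H ℕ.∸ suc n
      cancel : ∀ x y → y - (x ℤ.+ y) ≡ ℤ.- x
      cancel = solve-∀

  ∈-symmetricRange⁻ : ∀ {H z} → z ∈ symmetricRange H → ∣ z ∣ ≤ H
  ∈-symmetricRange⁻ {H} z∈ with i , i∈ , refl ← ∈-map⁻ (λ i → + i - + H) z∈ =
    subst (_≤ H) (sym (cong ∣_∣ ([+m]-[+n]≡m⊖n i H))) (∣i⊖H∣≤H (≤-pred (∈-upTo⁻ i∈)))
    where
    ∣i⊖H∣≤H : ∀ {i} → i ≤ H + H → ∣ i ℤ.⊖ H ∣ ≤ H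
    ∣i⊖H∣≤H {i} i≤H+H with ℕ.≤-total i H
    ... | inj₁ i≤H = subst (_≤ H) (sym (∣⊖∣-≤ i≤H)) (m∸n≤m H i)
    ... | inj₂ H≤i =
      subst (_≤ H) (sym (trans (∣m⊖n∣≡∣n⊖m∣ i H) (∣⊖∣-≤ H≤i))) (ℕ.m≤n+o⇒m∸n≤o i H i≤H+H)

  residue-class-count : ∀ {q} .{{_ : NonZero q}} H {P : ℤ → Set} →
                        (∀ {z z′} → P z → P z′ → z ≡ z′ mod q) →
                        {zs : List ℤ} → Unique zs → All (λ z → z ∈ symmetricRange H × P z) zs →
                        length zs ≤ suc ((H + H) / q)
  residue-class-count {q} H {P} congruent uzs ps =
    ≤-trans (Unique-length≤-by-code code code-injective code∈ uzs ps) (ℕ.≤-reflexive (length-upTo _))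
    where
    offset : ℕ → ℤ
    offset i = + i - + H
    code : ∀ {z} → z ∈ symmetricRange H × P z → ℕ
    code (z∈ , _) = proj₁ (∈-map⁻ offset z∈) / q
    code-injective : ∀ {z z′} (p : z ∈ symmetricRange H × P z) (p′ : z′ ∈ symmetricRange H × P z′) →
                     code p ≡ code p′ → z ≡ z′
    code-injective (z∈ , pz) (z′∈ , pz′) i/q≡i′/q with ∈-map⁻ offset z∈ | ∈-map⁻ offset z′∈
    ... | i , _ , refl | i′ , _ , refl =
      cong offset (/-cong∧≡-mod⇒≡ i/q≡i′/q (-‿cancelʳ-≡-mod (+ H) (congruent pz pz′)))
    code∈ : ∀ {z} (p : z ∈ symmetricRange H × P z) → code p ∈ upTo (suc ((H + H) / q))
    code∈ (z∈ , _) with i , i∈ , _ ← ∈-map⁻ offset z∈ =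
      ∈-upTo⁺ (s≤s (/-monoˡ-≤ q (≤-pred (∈-upTo⁻ i∈))))

module CountArithmetic where

  open import Data.Nat using (ℕ; suc; _+_; _*_; _^_; _≤_; >-nonZero)
  open import Data.Nat.Properties
  open import Data.Nat.Tactic.RingSolver using (solve-∀)
  open import Relation.Binary.PropositionalEquality using (_≡_; sym; cong)

  count⇒bound : ∀ {n q h₁ h₂ h₃ K D} → 1 ≤ h₂ → 1 ≤ D →
                n ≤ suc (suc (h₂ + h₂) * (K * (D + D))) → K * q ≤ q + (h₁ * h₃ + h₁ * h₃) →
                n * q ≤ (h₁ * h₂ * h₃ + h₂ ^ 3 + h₂ * q) * (16 * D)
  count⇒bound {n} {q} {h₁} {h₂} {h₃} {K} {D} 1≤h₂ 1≤D n≤ Kq≤ = begin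
    n * q                                              ≤⟨ *-monoˡ-≤ q n≤ ⟩
    q + W * (K * (D + D)) * q                          ≡⟨ regroup₁ q W K D ⟩
    q + W * (D + D) * (K * q)                          ≤⟨ +-monoʳ-≤ q (*-mono-≤ (*-monoˡ-≤ (D + D) W≤3h₂) Kq≤) ⟩
    q + 3 * h₂ * (D + D) * (q + (h₁ * h₃ + h₁ * h₃))   ≡⟨ regroup₂ q h₁ h₂ h₃ D ⟩
    q + 6 * D * (h₂ * q) + 12 * D * P                  ≤⟨ +-monoˡ-≤ (12 * D * P) (+-monoˡ-≤ (6 * D * (h₂ * q)) q≤h₂q) ⟩
    h₂ * q + 6 * D * (h₂ * q) + 12 * D * P             ≡⟨ regroup₃ (h₂ * q) D P ⟩
    (1 + 6 * D) * (h₂ * q) + 12 * D * P                ≤⟨ +-mono-≤ (*-monoˡ-≤ (h₂ * q) 1+6D≤16D) (*-monoˡ-≤ P 12D≤16D) ⟩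
    16 * D * (h₂ * q) + 16 * D * P                     ≡⟨ regroup₄ (h₂ * q) D P ⟩
    (P + h₂ * q) * (16 * D)                            ≤⟨ *-monoˡ-≤ (16 * D) (+-monoˡ-≤ (h₂ * q) (m≤m+n P (h₂ ^ 3))) ⟩
    (P + h₂ ^ 3 + h₂ * q) * (16 * D)                   ∎
    where
    open ≤-Reasoning
    W P : ℕ
    W = suc (h₂ + h₂)
    P = h₁ * h₂ * h₃
    q≤h₂q : q ≤ h₂ * q
    q≤h₂q = m≤n*m q h₂ {{>-nonZero 1≤h₂}}
    12D≤16D : 12 * D ≤ 16 * D
    12D≤16D = *-monoˡ-≤ D (m≤m+n 12 4)
    W≤3h₂ : W ≤ 3 * h₂
    W≤3h₂ = ≤-trans (+-monoˡ-≤ (h₂ + h₂) 1≤h₂) (≤-reflexive (triple h₂))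
      where
      triple : ∀ x → x + (x + x) ≡ 3 * x
      triple = solve-∀
    1+6D≤16D : 1 + 6 * D ≤ 16 * D
    1+6D≤16D = ≤-trans (+-monoˡ-≤ (6 * D) (≤-trans 1≤D (m≤n*m D 10))) (≤-reflexive (sym (*-distribʳ-+ D 10 6)))
    regroup₁ : ∀ q W K D → (1 + W * (K * (D + D))) * q ≡ q + W * (D + D) * (K * q)
    regroup₁ = solve-∀
    regroup₂ : ∀ q h₁ h₂ h₃ D → q + 3 * h₂ * (D + D) * (q + (h₁ * h₃ + h₁ * h₃)) ≡
                                q + 6 * D * (h₂ * q) + 12 * D * (h₁ * h₂ * h₃)
    regroup₂ = solve-∀
    regroup₃ : ∀ x D P → x + 6 * D * x + 12 * D * P ≡ (1 + 6 * D) * x + 12 * D * P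
    regroup₃ = solve-∀
    regroup₄ : ∀ x D P → 16 * D * x + 16 * D * P ≡ (P + x) * (16 * D)
    regroup₄ = solve-∀

  few⇒bound : ∀ {n q h₁ h₂ h₃ Z} → n ≤ q → q * q ≤ h₁ * h₃ → 1 ≤ h₂ → 1 ≤ Z →
              n * q ≤ (h₁ * h₂ * h₃ + h₂ ^ 3 + h₂ * q) * Z
  few⇒bound {n} {q} {h₁} {h₂} {h₃} {Z} n≤q q*q≤h₁h₃ 1≤h₂ 1≤Z = begin
    n * q                                 ≤⟨ *-monoˡ-≤ q n≤q ⟩
    q * q                                 ≤⟨ q*q≤h₁h₃ ⟩
    h₁ * h₃                               ≤⟨ *-monoˡ-≤ h₃ (m≤m*n h₁ h₂ {{>-nonZero 1≤h₂}}) ⟩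
    h₁ * h₂ * h₃                          ≤⟨ m≤m+n (h₁ * h₂ * h₃) (h₂ ^ 3) ⟩
    h₁ * h₂ * h₃ + h₂ ^ 3                 ≤⟨ m≤m+n (h₁ * h₂ * h₃ + h₂ ^ 3) (h₂ * q) ⟩
    h₁ * h₂ * h₃ + h₂ ^ 3 + h₂ * q        ≤⟨ m≤m*n _ Z {{>-nonZero 1≤Z}} ⟩
    (h₁ * h₂ * h₃ + h₂ ^ 3 + h₂ * q) * Z  ∎
    where open ≤-Reasoning

  16*2^[512L]≤2^[516L] : ∀ L → 1 ≤ L → 16 * 2 ^ (512 * L) ≤ 2 ^ (516 * L)
  16*2^[512L]≤2^[516L] L 1≤L = begin
    16 * 2 ^ (512 * L)          ≤⟨ *-monoˡ-≤ (2 ^ (512 * L)) (^-monoʳ-≤ 2 (*-monoʳ-≤ 4 1≤L)) ⟩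
    2 ^ (4 * L) * 2 ^ (512 * L) ≡⟨ ^-distribˡ-+-* 2 (4 * L) (512 * L) ⟨
    2 ^ (4 * L + 512 * L)       ≡⟨ cong (2 ^_) (*-distribʳ-+ L 4 512) ⟨
    2 ^ (516 * L)               ∎
    where open ≤-Reasoning

open import Defs
open ListCounting
open Divisors
open DivisorBound
open Congruences
open SymmetricRanges
open CountArithmetic
open import Data.Nat as ℕ using (ℕ; zero; suc; _+_; _*_; _^_; _≤_; _<_; z≤n; s≤s; NonZero; _/_; _<?_)
import Data.Nat.Properties as ℕ
open import Data.Nat.DivMod using (m/n*n≤m)
open import Data.Nat.Divisibility as ℕ∣ using (m∣m*n)
open import Data.Nat.Primality using (Prime; prime⇒nonZero; prime⇒nonTrivial)
open import Data.Fin as F using (Fin; toℕ)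
open import Data.Fin.Properties using (toℕ-injective; toℕ<n)
open import Data.Integer as ℤ using (ℤ; +_; -_; -[1+_]; ∣_∣)
open import Data.Integer.Properties using (abs-*)
import Data.Integer.Divisibility as ℤD
open import Data.Integer.Divisibility.Signed using (_∣_; ∣ᵤ⇒∣; ∣⇒∣ᵤ)
open import Data.Maybe using (Maybe; just; nothing)
open import Data.List using (List; _∷_; _++_; length; map; concatMap; filter)
open import Data.List.Properties using (length-map; length-++)
open import Data.List.Membership.Propositional using (_∈_)
open import Data.List.Membership.Propositional.Properties using (∈-map⁺; ∈-++⁺ˡ; ∈-++⁺ʳ; ∈-filter⁺; ∈-filter⁻)
open import Data.List.Relation.Unary.Any using (here; there)
open import Data.List.Relation.Unary.All as All using (All)
open import Data.List.Relation.Unary.Unique.Propositional using (Unique)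
open import Data.List.Relation.Unary.Unique.Propositional.Properties using (filter⁺)
open import Data.Product using (∃; _×_; _,_; proj₁; proj₂)
open import Data.Product.Properties using (,-injectiveˡ; ,-injectiveʳ)
open import Data.Sum using (_⊎_; inj₁; inj₂)
open import Relation.Binary.PropositionalEquality using (_≡_; refl; sym; trans; cong; cong₂; subst)
open import Relation.Nullary using (¬_; Dec; yes; no)
open import Relation.Unary using (Decidable)

±divisors : ℕ → List ℤ
±divisors N = map +_ (divisors N) ++ map (λ d → - + d) (divisors N)

length-±divisors : ∀ N → length (±divisors N) ≡ τ N + τ N
length-±divisors N =
  trans (length-++ (map +_ (divisors N))) (cong₂ _+_ (length-map +_ (divisors N)) (length-map _ (divisors N)))

∈-±divisors⁺ : ∀ {N} .{{_ : NonZero N}} x → ∣ x ∣ ℕ∣.∣ N → x ∈ ±divisors N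
∈-±divisors⁺     (+ n)    n∣N = ∈-++⁺ˡ (∈-map⁺ +_ (∈-divisors⁺ n∣N))
∈-±divisors⁺ {N} -[1+ n ] n∣N = ∈-++⁺ʳ (map +_ (divisors N)) (∈-map⁺ (λ d → - + d) (∈-divisors⁺ n∣N))

unlessZero : ∀ {A : Set} → ℕ → A → Maybe A
unlessZero zero    _ = nothing
unlessZero (suc _) x = just x

unlessZero-injective : ∀ {A : Set} {m n} {x y : A} → unlessZero m x ≡ unlessZero n y →
                       (m ≡ 0 × n ≡ 0) ⊎ (0 < m × 0 < n × x ≡ y)
unlessZero-injective {m = zero}  {zero}  _    = inj₁ (refl , refl)
unlessZero-injective {m = suc _} {suc _} refl = inj₂ (s≤s z≤n , s≤s z≤n , refl)

unlessZero-∈ : ∀ {A : Set} m {x : A} {xs} → (0 < m → x ∈ xs) → unlessZero m x ∈ nothing ∷ map just xs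
unlessZero-∈ zero    _    = here refl
unlessZero-∈ (suc _) x∈xs = there (∈-map⁺ just (x∈xs (s≤s z≤n)))

module Counting (m q : ℕ) (q-prime : Prime q) (a : Fin (3 + m) → ℤ)
                (q∤a : ∀ j → ¬ (+ q ℤD.∣ a j)) (h : Fin (3 + m) → ℕ) where

  instance
    q≢0 : NonZero q
    q≢0 = prime⇒nonZero q-prime

  2≤q : 2 ≤ q
  2≤q = ℕ.nonTrivial⇒n>1 q {{prime⇒nonTrivial q-prime}}

  j₁ j₂ j₃ : Fin (3 + m)
  j₁ = F.zero
  j₂ = F.suc F.zero
  j₃ = F.suc (F.suc F.zero)

  a₁ a₂ a₃ : ℤ
  a₁ = a j₁
  a₂ = a j₂
  a₃ = a j₃

  h₁ h₂ h₃ H : ℕ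
  h₁ = h j₁
  h₂ = h j₂
  h₃ = h j₃
  H = h₁ * h₃

  q∤ₛa : ∀ j → ¬ (+ q ∣ a j)
  q∤ₛa j q∣a = q∤a j (∣⇒∣ᵤ q∣a)

  U : Fin q → Set
  U = InU (3 + m) q a h

  multiplier : ∀ {u} → U u → ℕ
  multiplier (s , _) = s

  coordinate : ∀ {u} → U u → Fin (3 + m) → ℤ
  coordinate (_ , _ , _ , xs) j = proj₁ (xs j)

  ∣coordinate∣≤h : ∀ {u} (w : U u) j → ∣ coordinate w j ∣ ≤ h j
  ∣coordinate∣≤h (_ , _ , _ , xs) j = proj₁ (proj₂ (xs j))

  coordinate-≡ : ∀ {u} (w : U u) j →
                 + multiplier w ℤ.* a j ℤ.* (+ toℕ u) ℤ.^ suc (toℕ j) ≡ coordinate w j mod q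
  coordinate-≡ (_ , _ , _ , xs) j = mod-divides (∣ᵤ⇒∣ (proj₂ (proj₂ (xs j))))

  q∤multiplier : ∀ {u} (w : U u) → ¬ (+ q ∣ + multiplier w)
  q∤multiplier (s , 1≤s , s<q , _) = 0<s<q⇒∤ 1≤s s<q

  x₁ x₂ x₃ : ∀ {u} → U u → ℤ
  x₁ w = coordinate w j₁
  x₂ w = coordinate w j₂
  x₃ w = coordinate w j₃

  Admissible : ℤ → ℤ → Set
  Admissible x₂ M = a₂ ℤ.* a₂ ℤ.* M ≡ a₁ ℤ.* a₃ ℤ.* (x₂ ℤ.* x₂) mod q

  admissible? : ∀ x₂ → Decidable (Admissible x₂)
  admissible? x₂ M = ≡-mod? q (a₂ ℤ.* a₂ ℤ.* M) (a₁ ℤ.* a₃ ℤ.* (x₂ ℤ.* x₂))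

  admissible : ℤ → List ℤ
  admissible x₂ = filter (admissible? x₂) (symmetricRange H)

  candidatesWith : ℤ → List (ℤ × ℤ)
  candidatesWith x₂ = concatMap (λ M → map (_, x₂) (±divisors ∣ M ∣)) (admissible x₂)

  candidates : List (ℤ × ℤ)
  candidates = concatMap candidatesWith (symmetricRange h₂)

  q∤coordinate : ∀ {u} (w : U u) → 0 < toℕ u → ∀ j → ¬ (+ q ∣ coordinate w j)
  q∤coordinate {u} w 0<u j = ≡-mod-∤ (≡-mod-sym (coordinate-≡ w j))
    (∤*∤ q-prime (∤*∤ q-prime (q∤multiplier w) (q∤ₛa j)) (∤^ q-prime (0<s<q⇒∤ 0<u (toℕ<n u)) (suc (toℕ j))))

  x₁x₂∈candidates : ∀ {u} (w : U u) → 0 < toℕ u → (x₁ w , x₂ w) ∈ candidates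
  x₁x₂∈candidates {u} w 0<u =
    ∈-concatMap⁺′ candidatesWith (∈-symmetricRange⁺ (x₂ w) (∣coordinate∣≤h w j₂))
      (∈-concatMap⁺′ _ M∈admissible (∈-map⁺ (_, x₂ w) (∈-±divisors⁺ {{∣M∣≢0}} (x₁ w) x₁∣M)))
    where
    M : ℤ
    M = x₁ w ℤ.* x₃ w
    ∣M∣≡ : ∣ M ∣ ≡ ∣ x₁ w ∣ ℕ.* ∣ x₃ w ∣
    ∣M∣≡ = abs-* (x₁ w) (x₃ w)
    x₁∣M : ∣ x₁ w ∣ ℕ∣.∣ ∣ M ∣
    x₁∣M = subst (∣ x₁ w ∣ ℕ∣.∣_) (sym ∣M∣≡) (m∣m*n ∣ x₃ w ∣)
    ∣M∣≢0 : NonZero ∣ M ∣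
    ∣M∣≢0 = ∤⇒∣∣≢0 (∤*∤ q-prime (q∤coordinate w 0<u j₁) (q∤coordinate w 0<u j₃))
    M∈admissible : M ∈ admissible (x₂ w)
    M∈admissible = ∈-filter⁺ (admissible? (x₂ w)) (∈-symmetricRange⁺ M ∣M∣≤H)
      (quadratic-relation (+ multiplier w) a₁ a₂ a₃ (+ toℕ u)
        (coordinate-≡ w j₁) (coordinate-≡ w j₂) (coordinate-≡ w j₃))
      where
      ∣M∣≤H : ∣ M ∣ ≤ H
      ∣M∣≤H = subst (_≤ H) (sym ∣M∣≡) (ℕ.*-mono-≤ (∣coordinate∣≤h w j₁) (∣coordinate∣≤h w j₃))

  code : ∀ {u} → U u → Maybe (ℤ × ℤ)
  code {u} w = unlessZero (toℕ u) (x₁ w , x₂ w)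

  code-injective : ∀ {u u′} (w : U u) (w′ : U u′) → code w ≡ code w′ → u ≡ u′
  code-injective {u} {u′} w w′ eq with unlessZero-injective eq
  ... | inj₁ (u≡0 , u′≡0) = toℕ-injective (trans u≡0 (sym u′≡0))
  ... | inj₂ (_ , 0<u′ , x₁x₂≡x₁′x₂′) =
    toℕ-injective (≡-mod⇒≡ (toℕ<n u) (toℕ<n u′)
      (two-powers⇒≡-mod q-prime a₁ a₂ (+ multiplier w) (+ multiplier w′) (+ toℕ u) (+ toℕ u′)
        (q∤ₛa j₁) (q∤ₛa j₂) (q∤multiplier w′) (0<s<q⇒∤ 0<u′ (toℕ<n u′))
        (same-coordinate j₁ (,-injectiveˡ x₁x₂≡x₁′x₂′))
        (same-coordinate j₂ (,-injectiveʳ x₁x₂≡x₁′x₂′))))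
    where
    same-coordinate : ∀ (j : Fin (3 + m)) → coordinate w j ≡ coordinate w′ j →
      + multiplier w ℤ.* a j ℤ.* (+ toℕ u) ℤ.^ suc (toℕ j) ≡
      + multiplier w′ ℤ.* a j ℤ.* (+ toℕ u′) ℤ.^ suc (toℕ j) mod q
    same-coordinate j x≡x′ =
      ≡-mod-trans (coordinate-≡ w j) (≡-mod-trans (≡⇒≡-mod x≡x′) (≡-mod-sym (coordinate-≡ w′ j)))

  U-list-length≤ : ∀ {us} → Unique us → All U us → length us ≤ suc (length candidates)
  U-list-length≤ uus ws = ℕ.≤-trans
    (Unique-length≤-by-code code code-injective (λ {u} w → unlessZero-∈ (toℕ u) (x₁x₂∈candidates w)) uus ws)
    (ℕ.≤-reflexive (cong suc (length-map just candidates)))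

  length-admissible≤ : ∀ x₂ → length (admissible x₂) ≤ suc ((H + H) / q)
  length-admissible≤ x₂ = residue-class-count H congruent
    (filter⁺ (admissible? x₂) (symmetricRange-unique H))
    (All.tabulate (∈-filter⁻ (admissible? x₂)))
    where
    congruent : ∀ {M M′} → Admissible x₂ M → Admissible x₂ M′ → M ≡ M′ mod q
    congruent M-adm M′-adm =
      *-cancelˡ-≡-mod q-prime (∤*∤ q-prime (q∤ₛa j₂) (q∤ₛa j₂)) (≡-mod-trans M-adm (≡-mod-sym M′-adm))

  D : ℕ
  D = 2 ^ (512 * logRatio q)

  length-candidates≤ : H < q * q → length candidates ≤ suc (h₂ + h₂) * (suc ((H + H) / q) * (D + D))
  length-candidates≤ H<q*q = ℕ.≤-trans
    (length-concatMap≤ candidatesWith (symmetricRange h₂) (λ {x₂} _ → per-x₂ x₂))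
    (ℕ.≤-reflexive (cong (ℕ._* (suc ((H + H) / q) * (D + D))) (length-symmetricRange h₂)))
    where
    open ℕ.≤-Reasoning
    per-M : ∀ x₂ {M} → M ∈ admissible x₂ → length (map (_, x₂) (±divisors ∣ M ∣)) ≤ D + D
    per-M x₂ {M} M∈ = begin
      length (map (_, x₂) (±divisors ∣ M ∣))  ≡⟨ length-map (_, x₂) (±divisors ∣ M ∣) ⟩
      length (±divisors ∣ M ∣)                ≡⟨ length-±divisors ∣ M ∣ ⟩
      τ (∣ M ∣) + τ (∣ M ∣)                     ≤⟨ ℕ.+-mono-≤ τ∣M∣≤D τ∣M∣≤D ⟩
      D + D                                   ∎
      where
      τ∣M∣≤D : τ ∣ M ∣ ≤ D
      τ∣M∣≤D =
        τ-bound q 2≤q ∣ M ∣ (ℕ.≤-<-trans (∈-symmetricRange⁻ (proj₁ (∈-filter⁻ (admissible? x₂) M∈))) H<q*q)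
    per-x₂ : ∀ x₂ → length (candidatesWith x₂) ≤ suc ((H + H) / q) * (D + D)
    per-x₂ x₂ = ℕ.≤-trans (length-concatMap≤ _ (admissible x₂) (per-M x₂))
                          (ℕ.*-monoˡ-≤ (D + D) (length-admissible≤ x₂))

  card-U-bound : 1 ≤ h₁ → ((i j : Fin (3 + m)) → i F.≤ j → h i ≤ h j) →
                 (us : List (Fin q)) → Unique us → All U us →
                 length us * q ≤ (h₁ * h₂ * h₃ + h₂ ^ 3 + h₂ * q) * 2 ^ (516 * logRatio q)
  card-U-bound 1≤h₁ h-mono us uus us⊆U = by-cases (H <? q * q)
    where
    1≤h₂ : 1 ≤ h₂
    1≤h₂ = ℕ.≤-trans 1≤h₁ (h-mono j₁ j₂ z≤n)
    by-cases : Dec (H < q * q) → length us * q ≤ (h₁ * h₂ * h₃ + h₂ ^ 3 + h₂ * q) * 2 ^ (516 * logRatio q)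
    by-cases (yes H<q*q) = ℕ.≤-trans
      (count⇒bound {h₁ = h₁} {h₃ = h₃} {K = suc ((H + H) / q)} {D = D} 1≤h₂ (ℕ.m^n>0 2 (512 * logRatio q))
        (ℕ.≤-trans (U-list-length≤ uus us⊆U) (s≤s (length-candidates≤ H<q*q)))
        (ℕ.+-monoʳ-≤ q (m/n*n≤m (H + H) q)))
      (ℕ.*-monoʳ-≤ (h₁ * h₂ * h₃ + h₂ ^ 3 + h₂ * q) (16*2^[512L]≤2^[516L] (logRatio q) (1≤logRatio q 2≤q)))
    by-cases (no H≮q*q) = few⇒bound {h₁ = h₁} {h₃ = h₃}
      (Unique⇒length≤n uus) (ℕ.≮⇒≥ H≮q*q) 1≤h₂ (ℕ.m^n>0 2 (516 * logRatio q))

theorem2p2 : (m : ℕ) → ∃ λ (C : ℕ) →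
    (q : ℕ) → Prime q →
    (a : Fin (3 + m) → ℤ) → ((j : Fin (3 + m)) → ¬ ((+ q) ℤD.∣ a j)) →
    (h : Fin (3 + m) → ℕ) → 1 ≤ h F.zero →
    ((i j : Fin (3 + m)) → i F.≤ j → h i ≤ h j) →
    (us : List (Fin q)) → Unique us → All (InU (3 + m) q a h) us →
    length us * q ≤
      (h F.zero * h (F.suc F.zero) * h (F.suc (F.suc F.zero))
        + h (F.suc F.zero) ^ 3 + h (F.suc F.zero) * q)
      * 2 ^ (C * logRatio q)
theorem2p2 m = 516 , λ q q-prime a q∤a h → Counting.card-U-bound m q q-prime a q∤a h
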